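{- Let $p$ be a prime and let $k\le m<n$ be positive integers with $n\ge m+2k-2$. Let $\pi:\mathrm{GL}_2(\mathbb{Z}/p^n\mathbb{Z})\to\mathrm{GL}_2(\mathbb{Z}/p^m\mathbb{Z})$ be the reduction map. Suppose $H\le \mathrm{GL}_2(\mathbb{Z}/p^n\mathbb{Z})$ has $m$-uppertriangular tendencies and contains an element of the form $\begin{pmatrix} a & b\\ p^{k-1}c & d\end{pmatrix}$ with $c\not\equiv 0\pmod p$ and $a+d\not\equiv 0\pmod p$. Then $|H|\le p^{n-m+4k-4}\,|\pi(H)|$.
   Context: For a prime $\ell$ and integers $0\le m<n$, a subgroup $H\le\mathrm{GL}_2(\mathbb{Z}/\ell^n\mathbb{Z})$ has $m$-uppertriangular tendencies if for every $\begin{pmatrix} a&b\\ c&d\end{pmatrix}\in H$, $c\equiv 0\pmod{\ell^m}$ implies $c\equiv 0\pmod{\ell^n}$. -}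

module Defs where

open import Data.Nat using (ℕ; zero; suc; _+_; _*_; _∸_; _^_; _≤_; _<_; NonZero)
open import Data.Nat.Properties using (m^n≢0)
open import Data.Nat.DivMod using (_mod_)
open import Data.Nat.Divisibility using (_∣_)
open import Data.Nat.Primality using (Prime; prime⇒nonZero)
open import Data.Fin using (Fin; toℕ)
open import Data.Product using (Σ; _×_; _,_; ∃)
open import Data.List using (List)
open import Data.List.Membership.Propositional using (_∈_)
open import Relation.Binary.PropositionalEquality using (_≡_)

-- Throughout: p is a prime (proof pp), and ℤ/p^eℤ is modelled by Fin (p ^ e)
-- (canonical residues 0 … p^e - 1).

module _ {p : ℕ} (pp : Prime p) where

  red : (e : ℕ) → ℕ → Fin (p ^ e)
  red e x = x mod (p ^ e)
    where instance _ : NonZero (p ^ e)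
                   _ = m^n≢0 p e {{prime⇒nonZero pp}}

  record M2 (e : ℕ) : Set where
    constructor mat
    field
      a b c d : Fin (p ^ e)

  open M2 public

  _·_ : {e : ℕ} → M2 e → M2 e → M2 e
  _·_ {e} (mat a₁ b₁ c₁ d₁) (mat a₂ b₂ c₂ d₂) =
    mat (red e (toℕ a₁ * toℕ a₂ + toℕ b₁ * toℕ c₂))
        (red e (toℕ a₁ * toℕ b₂ + toℕ b₁ * toℕ d₂))
        (red e (toℕ c₁ * toℕ a₂ + toℕ d₁ * toℕ c₂))
        (red e (toℕ c₁ * toℕ b₂ + toℕ d₁ * toℕ d₂))

  I : {e : ℕ} → M2 e
  I {e} = mat (red e 1) (red e 0) (red e 0) (red e 1)

  IsGL : {e : ℕ} → M2 e → Set
  IsGL {e} g = Σ (M2 e) λ g' → (g · g' ≡ I) × (g' · g ≡ I)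

  π : {n : ℕ} (m : ℕ) → M2 n → M2 m
  π m (mat a b c d) = mat (red m (toℕ a)) (red m (toℕ b)) (red m (toℕ c)) (red m (toℕ d))

  -- A (finite) subgroup H ≤ GL₂(ℤ/p^nℤ), given by the list of its elements
  -- (duplicate-freeness is imposed separately in the statement).
  record IsSubgroup {n : ℕ} (H : List (M2 n)) : Set where
    field
      inGL   : ∀ {h} → h ∈ H → IsGL h
      hasI   : I ∈ H
      mulCl  : ∀ {g h} → g ∈ H → h ∈ H → (g · h) ∈ H
      invCl  : ∀ {h} → h ∈ H → Σ (M2 n) λ h' → (h' ∈ H) × (h · h' ≡ I) × (h' · h ≡ I)

  UpperTriTend : {n : ℕ} (m : ℕ) → List (M2 n) → Set
  UpperTriTend {n} m H = ∀ {h} → h ∈ H → p ^ m ∣ toℕ (c h) → p ^ n ∣ toℕ (c h)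

{-# OPTIONS --safe #-}
module Submission where

-- Let K be the kernel of π on H.  Fixing in every fibre of π a representative r ∈ H, the map
-- h ↦ (π h , r⁻¹ h) is injective, so |H| ≤ |π(H)| · |K|.  Now let g = (a b ; p^(k-1) c₀ d) ∈ H
-- with c₀ and a + d units, and x ∈ K.  The conjugates u = g x g⁻¹ and v = g⁻¹ x g lie in K, so
-- by the uppertriangular tendencies u, x and v are upper triangular in ℤ/p^n.  Comparing entries
-- of u g = g x and g v = x g and cancelling the unit c₀, the power p^(k-1) and the unit a + d
-- gives x₁₁ ≡ x₂₂ mod p^(n-k+1) and x₁₂ ≡ 0 mod p^(n-2k+2).  Since also x ≡ 1 mod p^m, such an x
-- is determined by the quotients of x₁₁, x₂₂, x₁₂ by p^m, p^(n-k+1), p^(n-2k+2), which gives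
-- |K| ≤ p^(n-m) · p^(k-1) · p^(2k-2).

open import Defs
open import Data.Nat.Base as ℕ using (ℕ; zero; suc; _∸_; _^_; _≤_; _<_; NonZero)
import Data.Nat.Properties as ℕₚ
open import Data.Nat.DivMod using (_%_; _/_; m≡m%n+[m/n]*n; m%n<n; m<n⇒m%n≡m; m<n*o⇒m/o<n)
open import Data.Nat.Divisibility
  using (_∣_; divides-refl; 1∣_; ∣-trans; m∣m*n; *-cancelʳ-∣; *-monoˡ-∣; n∣m⇒m%n≡0)
open import Data.Nat.Primality using (Prime; prime⇒nonZero; euclidsLemma)
import Data.Integer.Properties as ℤₚ
import Data.Integer.Divisibility.Signed as Signed
open import Data.Sum using (inj₁; inj₂)
open import Level using (0ℓ)
open import Relation.Nullary using (¬_; contradiction)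
open import Relation.Binary.Bundles using (Setoid)
open import Relation.Binary.Structures using (IsEquivalence)
open import Relation.Binary.PropositionalEquality

module IntegerCongruence where

  open import Data.Integer.Base using (ℤ; +_; 0ℤ; _+_; _-_; _*_; -_; ∣_∣)
  open import Data.Integer.Tactic.RingSolver using (solve-∀)

  infix 4 _≡_mod_

  -- A record rather than an abbreviation of the divisibility, so that x and y can be inferred.
  record _≡_mod_ (x y : ℤ) (M : ℕ) : Set where
    constructor congruent
    field modulus∣difference : + M Signed.∣ x - y


  private
    neg-difference : ∀ x y → - (x - y) ≡ y - x
    neg-difference = solve-∀
    difference-+ : ∀ x y z → (x - y) + (y - z) ≡ x - z
    difference-+ = solve-∀
    difference-+-cong : ∀ x x′ y y′ → (x - x′) + (y - y′) ≡ (x + y) - (x′ + y′)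
    difference-+-cong = solve-∀
    difference-*-cong : ∀ x x′ y y′ → y * (x - x′) + x′ * (y - y′) ≡ x * y - x′ * y′
    difference-*-cong = solve-∀
    difference-+-cancel : ∀ x y z → (x + z) - (y + z) ≡ x - y
    difference-+-cancel = solve-∀

  module _ {M : ℕ} where

    ≡⇒≡-mod : ∀ {x y} → x ≡ y → x ≡ y mod M
    ≡⇒≡-mod {x} refl = congruent (Signed.divides 0ℤ (ℤₚ.+-inverseʳ x))

    ≡-mod-refl : ∀ {x} → x ≡ x mod M
    ≡-mod-refl = ≡⇒≡-mod refl

    ≡-mod-sym : ∀ {x y} → x ≡ y mod M → y ≡ x mod M
    ≡-mod-sym {x} {y} (congruent M∣x-y) =
      congruent (subst (+ M Signed.∣_) (neg-difference x y) (Signed.∣m⇒∣-m M∣x-y))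

    ≡-mod-trans : ∀ {x y z} → x ≡ y mod M → y ≡ z mod M → x ≡ z mod M
    ≡-mod-trans {x} {y} {z} (congruent M∣x-y) (congruent M∣y-z) =
      congruent (subst (+ M Signed.∣_) (difference-+ x y z) (Signed.∣m∣n⇒∣m+n M∣x-y M∣y-z))

    ≡-mod-isEquivalence : IsEquivalence (λ x y → x ≡ y mod M)
    ≡-mod-isEquivalence = record { refl = ≡-mod-refl ; sym = ≡-mod-sym ; trans = ≡-mod-trans }

    +-cong-mod : ∀ {x x′ y y′} → x ≡ x′ mod M → y ≡ y′ mod M → x + y ≡ x′ + y′ mod M
    +-cong-mod {x} {x′} {y} {y′} (congruent M∣x-x′) (congruent M∣y-y′) =
      congruent (subst (+ M Signed.∣_) (difference-+-cong x x′ y y′) (Signed.∣m∣n⇒∣m+n M∣x-x′ M∣y-y′))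

    *-cong-mod : ∀ {x x′ y y′} → x ≡ x′ mod M → y ≡ y′ mod M → x * y ≡ x′ * y′ mod M
    *-cong-mod {x} {x′} {y} {y′} (congruent M∣x-x′) (congruent M∣y-y′) =
      congruent (subst (+ M Signed.∣_) (difference-*-cong x x′ y y′)
        (Signed.∣m∣n⇒∣m+n (Signed.∣n⇒∣m*n y M∣x-x′) (Signed.∣n⇒∣m*n x′ M∣y-y′)))

    +-cancelʳ-mod : ∀ {x y z} → x + z ≡ y + z mod M → x ≡ y mod M
    +-cancelʳ-mod {x} {y} {z} (congruent M∣difference) =
      congruent (subst (+ M Signed.∣_) (difference-+-cancel x y z) M∣difference)

    +-congˡ-mod : ∀ x {y z} → y ≡ z mod M → x + y ≡ x + z mod M
    +-congˡ-mod x = +-cong-mod (≡-mod-refl {x})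

    +-congʳ-mod : ∀ x {y z} → y ≡ z mod M → y + x ≡ z + x mod M
    +-congʳ-mod x y≡z = +-cong-mod y≡z (≡-mod-refl {x})

    *-congˡ-mod : ∀ x {y z} → y ≡ z mod M → x * y ≡ x * z mod M
    *-congˡ-mod x = *-cong-mod (≡-mod-refl {x})

    *-congʳ-mod : ∀ x {y z} → y ≡ z mod M → y * x ≡ z * x mod M
    *-congʳ-mod x y≡z = *-cong-mod y≡z (≡-mod-refl {x})

  ≡-mod-setoid : ℕ → Setoid 0ℓ 0ℓ
  ≡-mod-setoid M = record { isEquivalence = ≡-mod-isEquivalence {M} }

  ≡0-mod⇒∣ : ∀ {M x} → + x ≡ 0ℤ mod M → M ∣ x
  ≡0-mod⇒∣ {M} {x} (congruent M∣x) = subst (M ∣_) (ℕₚ.+-identityʳ x) (Signed.∣⇒∣ᵤ M∣x)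

  ∣⇒≡0-mod : ∀ {M x} → M ∣ x → + x ≡ 0ℤ mod M
  ∣⇒≡0-mod {M} {x} M∣x = congruent (Signed.∣ᵤ⇒∣ (subst (M ∣_) (sym (ℕₚ.+-identityʳ x)) M∣x))

  ≡-mod-weaken : ∀ {M N x y} → N ∣ M → x ≡ y mod M → x ≡ y mod N
  ≡-mod-weaken N∣M (congruent M∣x-y) = congruent (Signed.∣-trans (Signed.∣ᵤ⇒∣ N∣M) M∣x-y)

  +[a+k*M]≡+a : ∀ a k M → + (a ℕ.+ k ℕ.* M) ≡ + a mod M
  +[a+k*M]≡+a a k M = congruent (Signed.divides (+ k) (begin
      + (a ℕ.+ k ℕ.* M) - + a
        ≡⟨ cong (_- + a) (trans (ℤₚ.pos-+ a (k ℕ.* M)) (cong (_+_ (+ a)) (ℤₚ.pos-* k M))) ⟩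
      (+ a + + k * + M) - + a   ≡⟨ cancel (+ a) (+ k * + M) ⟩
      + k * + M                 ∎))
    where
    open ≡-Reasoning
    cancel : ∀ x y → (x + y) - x ≡ y
    cancel = solve-∀

  %-≡-mod : ∀ x M .{{_ : NonZero M}} → + (x % M) ≡ + x mod M
  %-≡-mod x M = ≡-mod-sym (subst (λ t → + t ≡ + (x % M) mod M) (sym (m≡m%n+[m/n]*n x M))
                                 (+[a+k*M]≡+a (x % M) (x / M) M))

  congruent-residues-≡ : ∀ {M r s} .{{_ : NonZero M}} → r < M → s < M → + r ≡ + s mod M → r ≡ s
  congruent-residues-≡ {M} {r} {s} r<M s<M (congruent M∣r-s) =
    ℤₚ.+-injective (ℤₚ.i-j≡0⇒i≡j (+ r) (+ s) (ℤₚ.∣i∣≡0⇒i≡0 ∣r-s∣≡0))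
    where
    ∣r-s∣<M : ∣ + r - + s ∣ < M
    ∣r-s∣<M = subst (_< M) (cong ∣_∣ (sym (ℤₚ.[+m]-[+n]≡m⊖n r s)))
                (ℕₚ.≤-<-trans (ℤₚ.∣m⊝n∣≤m⊔n r s) (ℕₚ.⊔-lub r<M s<M))
    ∣r-s∣≡0 : ∣ + r - + s ∣ ≡ 0
    ∣r-s∣≡0 = trans (sym (m<n⇒m%n≡m ∣r-s∣<M)) (n∣m⇒m%n≡0 _ M (Signed.∣⇒∣ᵤ M∣r-s))

  ≡-mod∧/≡⇒≡ : ∀ {M x y} .{{_ : NonZero M}} → + x ≡ + y mod M → x / M ≡ y / M → x ≡ y
  ≡-mod∧/≡⇒≡ {M} {x} {y} x≡y x/M≡y/M = begin
    x                        ≡⟨ m≡m%n+[m/n]*n x M ⟩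
    x % M ℕ.+ x / M ℕ.* M    ≡⟨ cong₂ (λ r q → r ℕ.+ q ℕ.* M) x%M≡y%M x/M≡y/M ⟩
    y % M ℕ.+ y / M ℕ.* M    ≡⟨ m≡m%n+[m/n]*n y M ⟨
    y                        ∎
    where
    open ≡-Reasoning
    x%M≡y%M : x % M ≡ y % M
    x%M≡y%M = congruent-residues-≡ (m%n<n x M) (m%n<n y M)
                (≡-mod-trans (%-≡-mod x M) (≡-mod-trans x≡y (≡-mod-sym (%-≡-mod y M))))

open IntegerCongruence

module PrimePowerCongruence {p : ℕ} (pp : Prime p) where

  open import Data.Integer.Base using (+_; _-_; _*_; ∣_∣)
  open import Data.Integer.Tactic.RingSolver using (solve-∀)

  instance
    p≢0 : NonZero p
    p≢0 = prime⇒nonZero pp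

  -- Not an instance: instance search cannot solve p ^ ?e = p ^ e, so every exponent in use gets
  -- its own local instance.
  pᵉ-nonZero : ∀ e → NonZero (p ^ e)
  pᵉ-nonZero e = ℕₚ.m^n≢0 p e

  private
    *-distribˡ-difference : ∀ w x y → w * x - w * y ≡ w * (x - y)
    *-distribˡ-difference = solve-∀

  pᵐ∣pⁿ : ∀ {m n} → m ≤ n → p ^ m ∣ p ^ n
  pᵐ∣pⁿ {m} {n} m≤n = subst (λ k → p ^ m ∣ p ^ k) (ℕₚ.m+[n∸m]≡n m≤n)
    (subst (p ^ m ∣_) (sym (ℕₚ.^-distribˡ-+-* p m (n ∸ m))) (m∣m*n (p ^ (n ∸ m))))

  module _ {e : ℕ} where

    private instance
      pᵉ≢0 : NonZero (p ^ e)
      pᵉ≢0 = pᵉ-nonZero e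

    x<pⁱ⁺ᵉ⇒x/pᵉ<pⁱ : ∀ i {x} → x < p ^ (i ℕ.+ e) → x / p ^ e < p ^ i
    x<pⁱ⁺ᵉ⇒x/pᵉ<pⁱ i {x} x<pⁱ⁺ᵉ = m<n*o⇒m/o<n (subst (x <_) (ℕₚ.^-distribˡ-+-* p i e) x<pⁱ⁺ᵉ)

  pᵉ∣w*x⇒pᵉ∣x : ∀ e {w x} → ¬ p ∣ w → p ^ e ∣ w ℕ.* x → p ^ e ∣ x
  pᵉ∣w*x⇒pᵉ∣x zero    {x = x} _ _ = 1∣ x
  pᵉ∣w*x⇒pᵉ∣x (suc e) {w} {x} p∤w pᵉ⁺¹∣wx
    with euclidsLemma w x pp (∣-trans (m∣m*n (p ^ e)) pᵉ⁺¹∣wx)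
  ... | inj₁ p∣w = contradiction p∣w p∤w
  ... | inj₂ (divides-refl q) =
    subst (_∣ q ℕ.* p) (ℕₚ.*-comm (p ^ e) p) (*-monoˡ-∣ p pᵉ∣q)
    where
    pᵉ∣q : p ^ e ∣ q
    pᵉ∣q = pᵉ∣w*x⇒pᵉ∣x e p∤w (*-cancelʳ-∣ p
      (subst₂ _∣_ (ℕₚ.*-comm p (p ^ e)) (sym (ℕₚ.*-assoc w q p)) pᵉ⁺¹∣wx))

  *-cancelˡ-≡-mod : ∀ e {w x y} → ¬ p ∣ ∣ w ∣ → w * x ≡ w * y mod p ^ e → x ≡ y mod p ^ e
  *-cancelˡ-≡-mod e {w} {x} {y} p∤w (congruent pᵉ∣wx-wy) =
    congruent (Signed.∣ᵤ⇒∣ (pᵉ∣w*x⇒pᵉ∣x e p∤w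
      (subst (p ^ e ∣_) (ℤₚ.abs-* w (x - y))
        (Signed.∣⇒∣ᵤ (subst (+ (p ^ e) Signed.∣_) (*-distribˡ-difference w x y) pᵉ∣wx-wy)))))

  pʲ*-cancelˡ-≡-mod : ∀ j e {x y} → + (p ^ j) * x ≡ + (p ^ j) * y mod p ^ (j ℕ.+ e) → x ≡ y mod p ^ e
  pʲ*-cancelˡ-≡-mod j e {x} {y} (congruent pʲ⁺ᵉ∣pʲx-pʲy) =
    congruent (Signed.*-cancelˡ-∣ (+ (p ^ j)) {{pᵉ-nonZero j}} (subst₂ Signed._∣_ pʲ⁺ᵉ≡pʲ*pᵉ
      (*-distribˡ-difference (+ (p ^ j)) x y) pʲ⁺ᵉ∣pʲx-pʲy))
    where
    pʲ⁺ᵉ≡pʲ*pᵉ : + (p ^ (j ℕ.+ e)) ≡ + (p ^ j) * + (p ^ e)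
    pʲ⁺ᵉ≡pʲ*pᵉ = trans (cong +_ (ℕₚ.^-distribˡ-+-* p j e)) (ℤₚ.pos-* (p ^ j) (p ^ e))

  pʲ-unit*-cancelˡ-≡-mod : ∀ j e {c c₀ x y} → c ≡ + (p ^ j) * c₀ mod p ^ (j ℕ.+ e) → ¬ p ∣ ∣ c₀ ∣ →
                          c * x ≡ c * y mod p ^ (j ℕ.+ e) → x ≡ y mod p ^ e
  pʲ-unit*-cancelˡ-≡-mod j e {c} {c₀} {x} {y} c≡pʲc₀ p∤c₀ cx≡cy =
    *-cancelˡ-≡-mod e {c₀} p∤c₀ (pʲ*-cancelˡ-≡-mod j e (begin
      + (p ^ j) * (c₀ * x)   ≡⟨ ℤₚ.*-assoc (+ (p ^ j)) c₀ x ⟨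
      + (p ^ j) * c₀ * x     ≈⟨ *-congʳ-mod x c≡pʲc₀ ⟨
      c * x                  ≈⟨ cx≡cy ⟩
      c * y                  ≈⟨ *-congʳ-mod y c≡pʲc₀ ⟩
      + (p ^ j) * c₀ * y     ≡⟨ ℤₚ.*-assoc (+ (p ^ j)) c₀ y ⟩
      + (p ^ j) * (c₀ * y)   ∎))
    where open import Relation.Binary.Reasoning.Setoid (≡-mod-setoid (p ^ (j ℕ.+ e)))


module IntegerMatrix where

  open import Data.Integer.Base using (ℤ; 0ℤ; 1ℤ; _+_; _*_)
  open import Data.Integer.Tactic.RingSolver using (solve-∀; solve)
  open import Data.List.Base using ([]; _∷_)

  record ℤMat : Set where
    constructor ℤmat
    field a₁₁ a₁₂ a₂₁ a₂₂ : ℤ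

  open ℤMat public

  infixl 7 _⊗_

  _⊗_ : ℤMat → ℤMat → ℤMat
  ℤmat x₁₁ x₁₂ x₂₁ x₂₂ ⊗ ℤmat y₁₁ y₁₂ y₂₁ y₂₂ =
    ℤmat (x₁₁ * y₁₁ + x₁₂ * y₂₁) (x₁₁ * y₁₂ + x₁₂ * y₂₂)
         (x₂₁ * y₁₁ + x₂₂ * y₂₁) (x₂₁ * y₁₂ + x₂₂ * y₂₂)

  𝟙 : ℤMat
  𝟙 = ℤmat 1ℤ 0ℤ 0ℤ 1ℤ

  trace : ℤMat → ℤ
  trace X = a₁₁ X + a₂₂ X

  UpperTriangular : ℕ → ℤMat → Set
  UpperTriangular M X = a₂₁ X ≡ 0ℤ mod M

  infix 4 _≋_mod_

  record _≋_mod_ (X Y : ℤMat) (M : ℕ) : Set where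
    constructor entrywise
    field
      ≋₁₁ : a₁₁ X ≡ a₁₁ Y mod M
      ≋₁₂ : a₁₂ X ≡ a₁₂ Y mod M
      ≋₂₁ : a₂₁ X ≡ a₂₁ Y mod M
      ≋₂₂ : a₂₂ X ≡ a₂₂ Y mod M

  open _≋_mod_ public

  ≋-weaken : ∀ {M N X Y} → N ∣ M → X ≋ Y mod M → X ≋ Y mod N
  ≋-weaken N∣M (entrywise e₁₁ e₁₂ e₂₁ e₂₂) =
    entrywise (≡-mod-weaken N∣M e₁₁) (≡-mod-weaken N∣M e₁₂)
              (≡-mod-weaken N∣M e₂₁) (≡-mod-weaken N∣M e₂₂)

  module _ {M : ℕ} where

    ≡⇒≋ : ∀ {X Y} → X ≡ Y → X ≋ Y mod M
    ≡⇒≋ refl = entrywise ≡-mod-refl ≡-mod-refl ≡-mod-refl ≡-mod-refl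

    ≋-sym : ∀ {X Y} → X ≋ Y mod M → Y ≋ X mod M
    ≋-sym (entrywise e₁₁ e₁₂ e₂₁ e₂₂) =
      entrywise (≡-mod-sym e₁₁) (≡-mod-sym e₁₂) (≡-mod-sym e₂₁) (≡-mod-sym e₂₂)

    ≋-trans : ∀ {X Y Z} → X ≋ Y mod M → Y ≋ Z mod M → X ≋ Z mod M
    ≋-trans (entrywise e₁₁ e₁₂ e₂₁ e₂₂) (entrywise f₁₁ f₁₂ f₂₁ f₂₂) =
      entrywise (≡-mod-trans e₁₁ f₁₁) (≡-mod-trans e₁₂ f₁₂)
                (≡-mod-trans e₂₁ f₂₁) (≡-mod-trans e₂₂ f₂₂)

    ⊗-cong : ∀ {X X′ Y Y′} → X ≋ X′ mod M → Y ≋ Y′ mod M → X ⊗ Y ≋ X′ ⊗ Y′ mod M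
    ⊗-cong {ℤmat _ _ _ _} {ℤmat _ _ _ _} {ℤmat _ _ _ _} {ℤmat _ _ _ _}
           (entrywise x₁₁ x₁₂ x₂₁ x₂₂) (entrywise y₁₁ y₁₂ y₂₁ y₂₂) =
      entrywise (+-cong-mod (*-cong-mod x₁₁ y₁₁) (*-cong-mod x₁₂ y₂₁))
                (+-cong-mod (*-cong-mod x₁₁ y₁₂) (*-cong-mod x₁₂ y₂₂))
                (+-cong-mod (*-cong-mod x₂₁ y₁₁) (*-cong-mod x₂₂ y₂₁))
                (+-cong-mod (*-cong-mod x₂₁ y₁₂) (*-cong-mod x₂₂ y₂₂))

    ⊗-congˡ : ∀ Z {X Y} → X ≋ Y mod M → Z ⊗ X ≋ Z ⊗ Y mod M
    ⊗-congˡ Z = ⊗-cong (≡⇒≋ {Z} refl)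

    ⊗-congʳ : ∀ Z {X Y} → X ≋ Y mod M → X ⊗ Z ≋ Y ⊗ Z mod M
    ⊗-congʳ Z X≋Y = ⊗-cong X≋Y (≡⇒≋ {Z} refl)

  ≋-setoid : ℕ → Setoid 0ℓ 0ℓ
  ≋-setoid M = record
    { Carrier = ℤMat
    ; _≈_ = λ X Y → X ≋ Y mod M
    ; isEquivalence = record { refl = ≡⇒≋ refl ; sym = ≋-sym ; trans = ≋-trans }
    }

  ℤmat-cong : ∀ {x₁₁ x₁₂ x₂₁ x₂₂ y₁₁ y₁₂ y₂₁ y₂₂} → x₁₁ ≡ y₁₁ → x₁₂ ≡ y₁₂ → x₂₁ ≡ y₂₁ → x₂₂ ≡ y₂₂ →
              ℤmat x₁₁ x₁₂ x₂₁ x₂₂ ≡ ℤmat y₁₁ y₁₂ y₂₁ y₂₂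
  ℤmat-cong refl refl refl refl = refl

  private
    row-assoc : ∀ x y y₁₁ y₁₂ y₂₁ y₂₂ z₁ z₂ →
      (x * y₁₁ + y * y₂₁) * z₁ + (x * y₁₂ + y * y₂₂) * z₂ ≡
      x * (y₁₁ * z₁ + y₁₂ * z₂) + y * (y₂₁ * z₁ + y₂₂ * z₂)
    row-assoc = solve-∀

  ⊗-assoc : ∀ X Y Z → (X ⊗ Y) ⊗ Z ≡ X ⊗ (Y ⊗ Z)
  ⊗-assoc (ℤmat x₁₁ x₁₂ x₂₁ x₂₂) (ℤmat y₁₁ y₁₂ y₂₁ y₂₂) (ℤmat z₁₁ z₁₂ z₂₁ z₂₂) =
    ℤmat-cong (row-assoc x₁₁ x₁₂ y₁₁ y₁₂ y₂₁ y₂₂ z₁₁ z₂₁)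
              (row-assoc x₁₁ x₁₂ y₁₁ y₁₂ y₂₁ y₂₂ z₁₂ z₂₂)
              (row-assoc x₂₁ x₂₂ y₁₁ y₁₂ y₂₁ y₂₂ z₁₁ z₂₁)
              (row-assoc x₂₁ x₂₂ y₁₁ y₁₂ y₂₁ y₂₂ z₁₂ z₂₂)

  ⊗-identityˡ : ∀ X → 𝟙 ⊗ X ≡ X
  ⊗-identityˡ (ℤmat x₁₁ x₁₂ x₂₁ x₂₂) =
    ℤmat-cong (solve (x₁₁ ∷ x₂₁ ∷ [])) (solve (x₁₂ ∷ x₂₂ ∷ []))
              (solve (x₁₁ ∷ x₂₁ ∷ [])) (solve (x₁₂ ∷ x₂₂ ∷ []))

  ⊗-identityʳ : ∀ X → X ⊗ 𝟙 ≡ X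
  ⊗-identityʳ (ℤmat x₁₁ x₁₂ x₂₁ x₂₂) =
    ℤmat-cong (solve (x₁₁ ∷ x₁₂ ∷ [])) (solve (x₁₁ ∷ x₁₂ ∷ []))
              (solve (x₂₁ ∷ x₂₂ ∷ [])) (solve (x₂₁ ∷ x₂₂ ∷ []))

  module _ {N : ℕ} where

    open import Relation.Binary.Reasoning.Setoid (≡-mod-setoid N)

    intertwining₁₁ : ∀ (G X Y : ℤMat) → UpperTriangular N Y → X ⊗ G ≋ G ⊗ Y mod N →
                     a₁₁ X * a₁₁ G + a₁₂ X * a₂₁ G ≡ a₁₁ G * a₁₁ Y mod N
    intertwining₁₁ (ℤmat g₁₁ g₁₂ g₂₁ g₂₂) (ℤmat x₁₁ x₁₂ x₂₁ x₂₂) (ℤmat y₁₁ y₁₂ y₂₁ y₂₂)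
                   y₂₁≡0 XG≋GY = begin
      x₁₁ * g₁₁ + x₁₂ * g₂₁    ≈⟨ ≋₁₁ XG≋GY ⟩
      g₁₁ * y₁₁ + g₁₂ * y₂₁    ≈⟨ +-congˡ-mod (g₁₁ * y₁₁) (*-congˡ-mod g₁₂ y₂₁≡0) ⟩
      g₁₁ * y₁₁ + g₁₂ * 0ℤ     ≡⟨ solve (g₁₁ ∷ g₁₂ ∷ y₁₁ ∷ []) ⟩
      g₁₁ * y₁₁                ∎

    intertwining₂₁ : ∀ (G X Y : ℤMat) → UpperTriangular N X → UpperTriangular N Y →
                     X ⊗ G ≋ G ⊗ Y mod N → a₂₂ X * a₂₁ G ≡ a₂₁ G * a₁₁ Y mod N
    intertwining₂₁ (ℤmat g₁₁ g₁₂ g₂₁ g₂₂) (ℤmat x₁₁ x₁₂ x₂₁ x₂₂) (ℤmat y₁₁ y₁₂ y₂₁ y₂₂)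
                   x₂₁≡0 y₂₁≡0 XG≋GY = begin
      x₂₂ * g₂₁                ≡⟨ solve (g₁₁ ∷ g₂₁ ∷ x₂₂ ∷ []) ⟩
      0ℤ * g₁₁ + x₂₂ * g₂₁     ≈⟨ +-congʳ-mod (x₂₂ * g₂₁) (*-congʳ-mod g₁₁ x₂₁≡0) ⟨
      x₂₁ * g₁₁ + x₂₂ * g₂₁    ≈⟨ ≋₂₁ XG≋GY ⟩
      g₂₁ * y₁₁ + g₂₂ * y₂₁    ≈⟨ +-congˡ-mod (g₂₁ * y₁₁) (*-congˡ-mod g₂₂ y₂₁≡0) ⟩
      g₂₁ * y₁₁ + g₂₂ * 0ℤ     ≡⟨ solve (g₂₁ ∷ g₂₂ ∷ y₁₁ ∷ []) ⟩
      g₂₁ * y₁₁                ∎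

    intertwining₂₂ : ∀ (G X Y : ℤMat) → UpperTriangular N X → X ⊗ G ≋ G ⊗ Y mod N →
                     a₂₂ X * a₂₂ G ≡ a₂₁ G * a₁₂ Y + a₂₂ G * a₂₂ Y mod N
    intertwining₂₂ (ℤmat g₁₁ g₁₂ g₂₁ g₂₂) (ℤmat x₁₁ x₁₂ x₂₁ x₂₂) (ℤmat y₁₁ y₁₂ y₂₁ y₂₂)
                   x₂₁≡0 XG≋GY = begin
      x₂₂ * g₂₂                ≡⟨ solve (g₁₂ ∷ g₂₂ ∷ x₂₂ ∷ []) ⟩
      0ℤ * g₁₂ + x₂₂ * g₂₂     ≈⟨ +-congʳ-mod (x₂₂ * g₂₂) (*-congʳ-mod g₁₂ x₂₁≡0) ⟨
      x₂₁ * g₁₂ + x₂₂ * g₂₂    ≈⟨ ≋₂₂ XG≋GY ⟩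
      g₂₁ * y₁₂ + g₂₂ * y₂₂    ∎

open IntegerMatrix

module ConjugationRigidity {p : ℕ} (pp : Prime p) where

  open import Data.Integer.Base using (+_; 0ℤ; _+_; _*_; ∣_∣)
  open import Data.Integer.Tactic.RingSolver using (solve)
  open import Data.List.Base using ([]; _∷_)
  open PrimePowerCongruence pp

  intertwining-diagonal : ∀ j e {c₀} (G X Y : ℤMat) →
    a₂₁ G ≡ + (p ^ j) * c₀ mod p ^ (j ℕ.+ e) → ¬ p ∣ ∣ c₀ ∣ →
    UpperTriangular (p ^ (j ℕ.+ e)) X → UpperTriangular (p ^ (j ℕ.+ e)) Y →
    X ⊗ G ≋ G ⊗ Y mod p ^ (j ℕ.+ e) → a₂₂ X ≡ a₁₁ Y mod p ^ e
  intertwining-diagonal j e G X Y c≡pʲc₀ p∤c₀ X↑ Y↑ XG≋GY =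
    pʲ-unit*-cancelˡ-≡-mod j e c≡pʲc₀ p∤c₀
      (≡-mod-trans (≡⇒≡-mod (ℤₚ.*-comm (a₂₁ G) (a₂₂ X))) (intertwining₂₁ G X Y X↑ Y↑ XG≋GY))

  -- The (2,2) entry of UG ≡ GK and the (1,1) entry of KG ≡ GV combine to (trace G)(k₁₁ - k₂₂) ≡ 0.
  intertwined-diagonal-≡ : ∀ j e {c₀} (G U K V : ℤMat) →
    a₂₁ G ≡ + (p ^ j) * c₀ mod p ^ (j ℕ.+ e) → ¬ p ∣ ∣ c₀ ∣ → ¬ p ∣ ∣ trace G ∣ →
    UpperTriangular (p ^ (j ℕ.+ e)) U → UpperTriangular (p ^ (j ℕ.+ e)) K →
    UpperTriangular (p ^ (j ℕ.+ e)) V →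
    U ⊗ G ≋ G ⊗ K mod p ^ (j ℕ.+ e) → K ⊗ G ≋ G ⊗ V mod p ^ (j ℕ.+ e) →
    a₁₁ K ≡ a₂₂ K mod p ^ e
  intertwined-diagonal-≡ j e G@(ℤmat g₁₁ g₁₂ g₂₁ g₂₂) U@(ℤmat u₁₁ u₁₂ u₂₁ u₂₂)
                         K@(ℤmat k₁₁ k₁₂ k₂₁ k₂₂) V@(ℤmat v₁₁ v₁₂ v₂₁ v₂₂)
                         c≡pʲc₀ p∤c₀ p∤trG U↑ K↑ V↑ UG≋GK KG≋GV =
    *-cancelˡ-≡-mod e {trace G} p∤trG (begin
      (g₁₁ + g₂₂) * k₁₁
        ≡⟨ solve (g₁₁ ∷ g₂₂ ∷ k₁₁ ∷ []) ⟩
      k₁₁ * g₁₁ + k₁₁ * g₂₂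
        ≈⟨ +-congˡ-mod (k₁₁ * g₁₁) (*-congʳ-mod g₂₂ u₂₂≡k₁₁) ⟨
      k₁₁ * g₁₁ + u₂₂ * g₂₂
        ≈⟨ +-congˡ-mod (k₁₁ * g₁₁) (weaken (intertwining₂₂ G U K U↑ UG≋GK)) ⟩
      k₁₁ * g₁₁ + (g₂₁ * k₁₂ + g₂₂ * k₂₂)
        ≡⟨ solve (g₁₁ ∷ g₂₁ ∷ g₂₂ ∷ k₁₁ ∷ k₁₂ ∷ k₂₂ ∷ []) ⟩
      (k₁₁ * g₁₁ + k₁₂ * g₂₁) + g₂₂ * k₂₂
        ≈⟨ +-congʳ-mod (g₂₂ * k₂₂) (weaken (intertwining₁₁ G K V V↑ KG≋GV)) ⟩
      g₁₁ * v₁₁ + g₂₂ * k₂₂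
        ≈⟨ +-congʳ-mod (g₂₂ * k₂₂) (*-congˡ-mod g₁₁ k₂₂≡v₁₁) ⟨
      g₁₁ * k₂₂ + g₂₂ * k₂₂
        ≡⟨ solve (g₁₁ ∷ g₂₂ ∷ k₂₂ ∷ []) ⟩
      (g₁₁ + g₂₂) * k₂₂
        ∎)
    where
    open import Relation.Binary.Reasoning.Setoid (≡-mod-setoid (p ^ e))
    weaken : ∀ {x y} → x ≡ y mod p ^ (j ℕ.+ e) → x ≡ y mod p ^ e
    weaken = ≡-mod-weaken (pᵐ∣pⁿ (ℕₚ.m≤n+m e j))
    u₂₂≡k₁₁ : u₂₂ ≡ k₁₁ mod p ^ e
    u₂₂≡k₁₁ = intertwining-diagonal j e G U K c≡pʲc₀ p∤c₀ U↑ K↑ UG≋GK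
    k₂₂≡v₁₁ : k₂₂ ≡ v₁₁ mod p ^ e
    k₂₂≡v₁₁ = intertwining-diagonal j e G K V c≡pʲc₀ p∤c₀ K↑ V↑ KG≋GV

  intertwined-upperRight-≡0 : ∀ j e {c₀} (G U K V : ℤMat) →
    a₂₁ G ≡ + (p ^ j) * c₀ mod p ^ (j ℕ.+ (j ℕ.+ e)) → ¬ p ∣ ∣ c₀ ∣ → ¬ p ∣ ∣ trace G ∣ →
    UpperTriangular (p ^ (j ℕ.+ (j ℕ.+ e))) U → UpperTriangular (p ^ (j ℕ.+ (j ℕ.+ e))) K →
    UpperTriangular (p ^ (j ℕ.+ (j ℕ.+ e))) V →
    U ⊗ G ≋ G ⊗ K mod p ^ (j ℕ.+ (j ℕ.+ e)) → K ⊗ G ≋ G ⊗ V mod p ^ (j ℕ.+ (j ℕ.+ e)) →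
    a₁₂ K ≡ 0ℤ mod p ^ e
  intertwined-upperRight-≡0 j e G@(ℤmat g₁₁ g₁₂ g₂₁ g₂₂) U K@(ℤmat k₁₁ k₁₂ k₂₁ k₂₂) V
                            c≡pʲc₀ p∤c₀ p∤trG U↑ K↑ V↑ UG≋GK KG≋GV =
    pʲ-unit*-cancelˡ-≡-mod j e (weaken c≡pʲc₀) p∤c₀ (+-cancelʳ-mod (begin
      g₂₁ * k₁₂ + g₂₂ * k₂₂    ≈⟨ weaken (intertwining₂₂ G U K U↑ UG≋GK) ⟨
      a₂₂ U * g₂₂              ≈⟨ *-congʳ-mod g₂₂ u₂₂≡k₂₂ ⟩
      k₂₂ * g₂₂                ≡⟨ solve (g₂₁ ∷ g₂₂ ∷ k₂₂ ∷ []) ⟩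
      g₂₁ * 0ℤ + g₂₂ * k₂₂     ∎))
    where
    open import Relation.Binary.Reasoning.Setoid (≡-mod-setoid (p ^ (j ℕ.+ e)))
    weaken : ∀ {x y} → x ≡ y mod p ^ (j ℕ.+ (j ℕ.+ e)) → x ≡ y mod p ^ (j ℕ.+ e)
    weaken = ≡-mod-weaken (pᵐ∣pⁿ (ℕₚ.m≤n+m (j ℕ.+ e) j))
    u₂₂≡k₂₂ : a₂₂ U ≡ k₂₂ mod p ^ (j ℕ.+ e)
    u₂₂≡k₂₂ = ≡-mod-trans
      (intertwining-diagonal j (j ℕ.+ e) G U K c≡pʲc₀ p∤c₀ U↑ K↑ UG≋GK)
      (intertwined-diagonal-≡ j (j ℕ.+ e) G U K V c≡pʲc₀ p∤c₀ p∤trG U↑ K↑ V↑ UG≋GK KG≋GV)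

module MatricesModPrimePower {p : ℕ} (pp : Prime p) where

  open import Data.Integer.Base using (+_; _+_; _*_)
  open import Data.Fin.Base using (Fin; toℕ)
  open import Data.Fin.Properties using (toℕ-fromℕ<; toℕ<n; toℕ-injective)
  import Data.Fin.Properties as Fin
  open import Data.Product.Base using (_,_)
  open import Relation.Nullary.Decidable using (map′; _×-dec_)
  open import Relation.Binary.Definitions using (DecidableEquality)
  open PrimePowerCongruence pp

  infixl 7 _∙_

  _∙_ : ∀ {e} → M2 pp e → M2 pp e → M2 pp e
  _∙_ = _·_ pp

  ε : ∀ {e} → M2 pp e
  ε = I pp

  ⌜_⌝ : ∀ {e} → M2 pp e → ℤMat
  ⌜ mat a b c d ⌝ = ℤmat (+ toℕ a) (+ toℕ b) (+ toℕ c) (+ toℕ d)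

  _≟_ : ∀ {e} → DecidableEquality (M2 pp e)
  mat a b c d ≟ mat a′ b′ c′ d′ =
    map′ (λ { (refl , refl , refl , refl) → refl }) (λ { refl → refl , refl , refl , refl })
         (a Fin.≟ a′ ×-dec b Fin.≟ b′ ×-dec c Fin.≟ c′ ×-dec d Fin.≟ d′)

  module _ {e : ℕ} where

    private instance
      pᵉ≢0 : NonZero (p ^ e)
      pᵉ≢0 = pᵉ-nonZero e

    red-≡-mod : ∀ x → + toℕ (red pp e x) ≡ + x mod p ^ e
    red-≡-mod x = subst (λ t → + t ≡ + x mod p ^ e) (sym (toℕ-fromℕ< _)) (%-≡-mod x (p ^ e))

    red-bilinear-≡-mod : ∀ x y z w → + toℕ (red pp e (x ℕ.* y ℕ.+ z ℕ.* w)) ≡ + x * + y + + z * + w mod p ^ e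
    red-bilinear-≡-mod x y z w =
      subst (λ t → + toℕ (red pp e (x ℕ.* y ℕ.+ z ℕ.* w)) ≡ t mod p ^ e)
            (trans (ℤₚ.pos-+ (x ℕ.* y) (z ℕ.* w)) (cong₂ _+_ (ℤₚ.pos-* x y) (ℤₚ.pos-* z w)))
            (red-≡-mod (x ℕ.* y ℕ.+ z ℕ.* w))

    ⌜⌝-∙ : ∀ (A B : M2 pp e) → ⌜ A ∙ B ⌝ ≋ ⌜ A ⌝ ⊗ ⌜ B ⌝ mod p ^ e
    ⌜⌝-∙ (mat a₁ b₁ c₁ d₁) (mat a₂ b₂ c₂ d₂) =
      entrywise (red-bilinear-≡-mod (toℕ a₁) (toℕ a₂) (toℕ b₁) (toℕ c₂))
                (red-bilinear-≡-mod (toℕ a₁) (toℕ b₂) (toℕ b₁) (toℕ d₂))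
                (red-bilinear-≡-mod (toℕ c₁) (toℕ a₂) (toℕ d₁) (toℕ c₂))
                (red-bilinear-≡-mod (toℕ c₁) (toℕ b₂) (toℕ d₁) (toℕ d₂))

    ⌜⌝-ε : ⌜ ε {e} ⌝ ≋ 𝟙 mod p ^ e
    ⌜⌝-ε = entrywise (red-≡-mod 1) (red-≡-mod 0) (red-≡-mod 0) (red-≡-mod 1)

    ⌜⌝-π : ∀ {n} (A : M2 pp n) → ⌜ π pp e A ⌝ ≋ ⌜ A ⌝ mod p ^ e
    ⌜⌝-π (mat a b c d) =
      entrywise (red-≡-mod (toℕ a)) (red-≡-mod (toℕ b)) (red-≡-mod (toℕ c)) (red-≡-mod (toℕ d))

    toℕ-≡-mod⇒≡ : ∀ (i j : Fin (p ^ e)) → + toℕ i ≡ + toℕ j mod p ^ e → i ≡ j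
    toℕ-≡-mod⇒≡ i j i≡j = toℕ-injective (congruent-residues-≡ (toℕ<n i) (toℕ<n j) i≡j)

    ⌜⌝-injective : ∀ {A B : M2 pp e} → ⌜ A ⌝ ≋ ⌜ B ⌝ mod p ^ e → A ≡ B
    ⌜⌝-injective {mat a b c d} {mat a′ b′ c′ d′} (entrywise e₁₁ e₁₂ e₂₁ e₂₂)
      with refl ← toℕ-≡-mod⇒≡ a a′ e₁₁ | refl ← toℕ-≡-mod⇒≡ b b′ e₁₂
         | refl ← toℕ-≡-mod⇒≡ c c′ e₂₁ | refl ← toℕ-≡-mod⇒≡ d d′ e₂₂ = refl

    ∙-assoc : ∀ (A B C : M2 pp e) → (A ∙ B) ∙ C ≡ A ∙ (B ∙ C)
    ∙-assoc A B C = ⌜⌝-injective (begin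
      ⌜ (A ∙ B) ∙ C ⌝             ≈⟨ ⌜⌝-∙ (A ∙ B) C ⟩
      ⌜ A ∙ B ⌝ ⊗ ⌜ C ⌝           ≈⟨ ⊗-congʳ ⌜ C ⌝ (⌜⌝-∙ A B) ⟩
      ⌜ A ⌝ ⊗ ⌜ B ⌝ ⊗ ⌜ C ⌝       ≡⟨ ⊗-assoc ⌜ A ⌝ ⌜ B ⌝ ⌜ C ⌝ ⟩
      ⌜ A ⌝ ⊗ (⌜ B ⌝ ⊗ ⌜ C ⌝)     ≈⟨ ⊗-congˡ ⌜ A ⌝ (⌜⌝-∙ B C) ⟨
      ⌜ A ⌝ ⊗ ⌜ B ∙ C ⌝           ≈⟨ ⌜⌝-∙ A (B ∙ C) ⟨
      ⌜ A ∙ (B ∙ C) ⌝             ∎)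
      where open import Relation.Binary.Reasoning.Setoid (≋-setoid (p ^ e))

    ∙-identityˡ : ∀ (A : M2 pp e) → ε ∙ A ≡ A
    ∙-identityˡ A = ⌜⌝-injective (begin
      ⌜ ε ∙ A ⌝         ≈⟨ ⌜⌝-∙ ε A ⟩
      ⌜ ε {e} ⌝ ⊗ ⌜ A ⌝ ≈⟨ ⊗-congʳ ⌜ A ⌝ ⌜⌝-ε ⟩
      𝟙 ⊗ ⌜ A ⌝         ≡⟨ ⊗-identityˡ ⌜ A ⌝ ⟩
      ⌜ A ⌝             ∎)
      where open import Relation.Binary.Reasoning.Setoid (≋-setoid (p ^ e))

    ∙-identityʳ : ∀ (A : M2 pp e) → A ∙ ε ≡ A
    ∙-identityʳ A = ⌜⌝-injective (begin
      ⌜ A ∙ ε ⌝         ≈⟨ ⌜⌝-∙ A ε ⟩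
      ⌜ A ⌝ ⊗ ⌜ ε {e} ⌝ ≈⟨ ⊗-congˡ ⌜ A ⌝ ⌜⌝-ε ⟩
      ⌜ A ⌝ ⊗ 𝟙         ≡⟨ ⊗-identityʳ ⌜ A ⌝ ⟩
      ⌜ A ⌝             ∎)
      where open import Relation.Binary.Reasoning.Setoid (≋-setoid (p ^ e))

    ∙-cancelˡ-by-inverse : ∀ (r s : M2 pp e) {A B} → r ∙ s ≡ ε → s ∙ A ≡ s ∙ B → A ≡ B
    ∙-cancelˡ-by-inverse r s {A} {B} rs≡ε sA≡sB = begin
      A              ≡⟨ ∙-identityˡ A ⟨
      ε ∙ A          ≡⟨ cong (_∙ A) rs≡ε ⟨
      r ∙ s ∙ A      ≡⟨ ∙-assoc r s A ⟩
      r ∙ (s ∙ A)    ≡⟨ cong (r ∙_) sA≡sB ⟩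
      r ∙ (s ∙ B)    ≡⟨ ∙-assoc r s B ⟨
      r ∙ s ∙ B      ≡⟨ cong (_∙ B) rs≡ε ⟩
      ε ∙ B          ≡⟨ ∙-identityˡ B ⟩
      B              ∎
      where open ≡-Reasoning

    conjugate-intertwinesʳ : ∀ {g g′ k : M2 pp e} → g′ ∙ g ≡ ε → g ∙ k ∙ g′ ∙ g ≡ g ∙ k
    conjugate-intertwinesʳ {g} {g′} {k} g′g≡ε = begin
      g ∙ k ∙ g′ ∙ g      ≡⟨ ∙-assoc (g ∙ k) g′ g ⟩
      g ∙ k ∙ (g′ ∙ g)    ≡⟨ cong (g ∙ k ∙_) g′g≡ε ⟩
      g ∙ k ∙ ε           ≡⟨ ∙-identityʳ (g ∙ k) ⟩
      g ∙ k               ∎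
      where open ≡-Reasoning

    conjugate-intertwinesˡ : ∀ {g g′ k : M2 pp e} → g ∙ g′ ≡ ε → g ∙ (g′ ∙ k ∙ g) ≡ k ∙ g
    conjugate-intertwinesˡ {g} {g′} {k} gg′≡ε = begin
      g ∙ (g′ ∙ k ∙ g)    ≡⟨ ∙-assoc g (g′ ∙ k) g ⟨
      g ∙ (g′ ∙ k) ∙ g    ≡⟨ cong (_∙ g) (∙-assoc g g′ k) ⟨
      g ∙ g′ ∙ k ∙ g      ≡⟨ cong (λ x → x ∙ k ∙ g) gg′≡ε ⟩
      ε ∙ k ∙ g           ≡⟨ cong (_∙ g) (∙-identityˡ k) ⟩
      k ∙ g               ∎
      where open ≡-Reasoning

    ⌜⌝-intertwining : ∀ (X G Y : M2 pp e) → X ∙ G ≡ G ∙ Y →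
                      ⌜ X ⌝ ⊗ ⌜ G ⌝ ≋ ⌜ G ⌝ ⊗ ⌜ Y ⌝ mod p ^ e
    ⌜⌝-intertwining X G Y XG≡GY = begin
      ⌜ X ⌝ ⊗ ⌜ G ⌝     ≈⟨ ⌜⌝-∙ X G ⟨
      ⌜ X ∙ G ⌝         ≡⟨ cong ⌜_⌝ XG≡GY ⟩
      ⌜ G ∙ Y ⌝         ≈⟨ ⌜⌝-∙ G Y ⟩
      ⌜ G ⌝ ⊗ ⌜ Y ⌝     ∎
      where open import Relation.Binary.Reasoning.Setoid (≋-setoid (p ^ e))

  module _ {m n : ℕ} (m≤n : m ≤ n) where

    open import Relation.Binary.Reasoning.Setoid (≋-setoid (p ^ m))

    π-∙ : ∀ (A B : M2 pp n) → π pp m (A ∙ B) ≡ π pp m A ∙ π pp m B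
    π-∙ A B = ⌜⌝-injective (begin
      ⌜ π pp m (A ∙ B) ⌝                ≈⟨ ⌜⌝-π {m} (A ∙ B) ⟩
      ⌜ A ∙ B ⌝                         ≈⟨ ≋-weaken (pᵐ∣pⁿ m≤n) (⌜⌝-∙ A B) ⟩
      ⌜ A ⌝ ⊗ ⌜ B ⌝                     ≈⟨ ⊗-cong (⌜⌝-π {m} A) (⌜⌝-π {m} B) ⟨
      ⌜ π pp m A ⌝ ⊗ ⌜ π pp m B ⌝       ≈⟨ ⌜⌝-∙ (π pp m A) (π pp m B) ⟨
      ⌜ π pp m A ∙ π pp m B ⌝           ∎)

    π-ε : π pp m (ε {n}) ≡ ε
    π-ε = ⌜⌝-injective (begin
      ⌜ π pp m (ε {n}) ⌝    ≈⟨ ⌜⌝-π {m} (ε {n}) ⟩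
      ⌜ ε {n} ⌝             ≈⟨ ≋-weaken (pᵐ∣pⁿ m≤n) (⌜⌝-ε {n}) ⟩
      𝟙                     ≈⟨ ⌜⌝-ε {m} ⟨
      ⌜ ε {m} ⌝             ∎)

open import Data.Nat.Base using (_+_; _*_)
open import Data.Fin.Base using (Fin; toℕ)
open import Data.Product.Base using (Σ; _×_; _,_; proj₁; proj₂)
open import Data.List.Base using (List; length; cartesianProduct; upTo)
open import Data.List.Membership.Propositional using (_∈_)
open import Data.List.Relation.Unary.Unique.Propositional using (Unique)
open import Function.Bundles using (_⇔_; Equivalence)

module ListCounting where

  open import Data.List.Base using ([]; _∷_; lookup; map)
  open import Data.List.Properties using (length-++; length-map)
  open import Data.List.Membership.Propositional.Properties using (∈-lookup)
  open import Data.List.Relation.Unary.Any using (index)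
  open import Data.List.Relation.Unary.Any.Properties using (lookup-index)
  import Data.List.Relation.Unary.All as All
  open import Data.List.Relation.Unary.AllPairs using (_∷_)
  open import Data.Fin.Base using (zero; suc)
  open import Data.Fin.Properties using (injective⇒≤)

  lookup-injective : ∀ {A : Set} {xs : List A} → Unique xs → ∀ {i j} → lookup xs i ≡ lookup xs j → i ≡ j
  lookup-injective (_ ∷ _)       {zero}  {zero}  _ = refl
  lookup-injective (x∉xs ∷ _)    {zero}  {suc j} x≡xsⱼ =
    contradiction x≡xsⱼ (All.lookup x∉xs (∈-lookup j))
  lookup-injective (x∉xs ∷ _)    {suc i} {zero}  xsᵢ≡x =
    contradiction (sym xsᵢ≡x) (All.lookup x∉xs (∈-lookup i))
  lookup-injective (_ ∷ unique)  {suc i} {suc j} xsᵢ≡xsⱼ = cong suc (lookup-injective unique xsᵢ≡xsⱼ)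

  injectiveOn⇒length≤ : ∀ {A B : Set} {xs : List A} {ys : List B} (f : A → B) → Unique xs →
                        (∀ {x} → x ∈ xs → f x ∈ ys) →
                        (∀ {x y} → x ∈ xs → y ∈ xs → f x ≡ f y → x ≡ y) →
                        length xs ≤ length ys
  injectiveOn⇒length≤ {xs = xs} {ys} f unique f∈ys f-injective = injective⇒≤ φ-injective
    where
    φ : Fin (length xs) → Fin (length ys)
    φ i = index (f∈ys (∈-lookup i))

    φ-injective : ∀ {i j} → φ i ≡ φ j → i ≡ j
    φ-injective {i} {j} φi≡φj = lookup-injective unique (f-injective (∈-lookup i) (∈-lookup j) (begin
      f (lookup xs i)   ≡⟨ lookup-index (f∈ys (∈-lookup i)) ⟩
      lookup ys (φ i)   ≡⟨ cong (lookup ys) φi≡φj ⟩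
      lookup ys (φ j)   ≡⟨ lookup-index (f∈ys (∈-lookup j)) ⟨
      f (lookup xs j)   ∎))
      where open ≡-Reasoning

  length-cartesianProduct : ∀ {A B : Set} (xs : List A) (ys : List B) →
                            length (cartesianProduct xs ys) ≡ length xs * length ys
  length-cartesianProduct []       ys = refl
  length-cartesianProduct (x ∷ xs) ys =
    trans (length-++ (map (x ,_) ys))
          (cong₂ _+_ (length-map (x ,_) ys) (length-cartesianProduct xs ys))

open ListCounting

module KernelOfReduction {p : ℕ} (pp : Prime p) {m n : ℕ} (m≤n : m ≤ n)
                         (H : List (M2 pp n)) (H≤ : IsSubgroup pp H) where

  open import Data.Integer.Base as ℤ using (+_; 0ℤ)
  open import Data.Fin.Properties using (toℕ<n)
  open import Data.List.Membership.Propositional using (find)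
  open import Data.List.Membership.Propositional.Properties using (∈-cartesianProduct⁺; ∈-upTo⁺)
  open import Data.List.Properties using (length-upTo)
  import Data.List.Relation.Unary.Any as Any
  open import Function.Base using (_∘_)
  open import Relation.Nullary.Decidable using (yes; no)
  open PrimePowerCongruence pp
  open MatricesModPrimePower pp
  open ConjugationRigidity pp
  open IsSubgroup H≤

  InKernel : M2 pp n → Set
  InKernel k = k ∈ H × π pp m k ≡ ε

  kernel-conjugate : ∀ {g g′ k} → g ∈ H → g′ ∈ H → g ∙ g′ ≡ ε →
                     InKernel k → InKernel (g ∙ k ∙ g′)
  kernel-conjugate {g} {g′} {k} g∈H g′∈H gg′≡ε (k∈H , πk≡ε) =
    mulCl (mulCl g∈H k∈H) g′∈H , (begin
    π pp m (g ∙ k ∙ g′)                 ≡⟨ π-∙ m≤n (g ∙ k) g′ ⟩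
    π pp m (g ∙ k) ∙ π pp m g′          ≡⟨ cong (_∙ π pp m g′) (π-∙ m≤n g k) ⟩
    π pp m g ∙ π pp m k ∙ π pp m g′     ≡⟨ cong (λ x → π pp m g ∙ x ∙ π pp m g′) πk≡ε ⟩
    π pp m g ∙ ε ∙ π pp m g′            ≡⟨ cong (_∙ π pp m g′) (∙-identityʳ (π pp m g)) ⟩
    π pp m g ∙ π pp m g′                ≡⟨ π-∙ m≤n g g′ ⟨
    π pp m (g ∙ g′)                     ≡⟨ cong (π pp m) gg′≡ε ⟩
    π pp m (ε {n})                      ≡⟨ π-ε m≤n ⟩
    ε                                   ∎)
    where open ≡-Reasoning

  kernel-≋𝟙 : ∀ {k} → InKernel k → ⌜ k ⌝ ≋ 𝟙 mod p ^ m
  kernel-≋𝟙 {k} (_ , πk≡ε) = begin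
    ⌜ k ⌝              ≈⟨ ⌜⌝-π {m} k ⟨
    ⌜ π pp m k ⌝       ≡⟨ cong ⌜_⌝ πk≡ε ⟩
    ⌜ ε {m} ⌝          ≈⟨ ⌜⌝-ε {m} ⟩
    𝟙                  ∎
    where open import Relation.Binary.Reasoning.Setoid (≋-setoid (p ^ m))

  record FibreInverse (x : M2 pp m) (s : M2 pp n) : Set where
    field
      representative   : M2 pp n
      π-representative : π pp m representative ≡ x
      representative∙s : representative ∙ s ≡ ε
      s∙representative : s ∙ representative ≡ ε
      s∈H              : s ∈ H

  -- The junk value ε outside π(H) is never used.
  fibreInverse : M2 pp m → M2 pp n
  fibreInverse x with Any.any? (λ r → π pp m r ≟ x) H
  ... | yes r∈fibre = proj₁ (invCl (proj₁ (proj₂ (find r∈fibre))))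
  ... | no _        = ε

  fibreInverse-spec : ∀ {h} → h ∈ H → FibreInverse (π pp m h) (fibreInverse (π pp m h))
  fibreInverse-spec {h} h∈H with Any.any? (λ r → π pp m r ≟ π pp m h) H
  ... | yes r∈fibre =
    let r , r∈H , πr≡πh = find r∈fibre
        _ , s∈H , rs≡ε , sr≡ε = invCl r∈H
    in record { representative = r ; π-representative = πr≡πh
              ; representative∙s = rs≡ε ; s∙representative = sr≡ε ; s∈H = s∈H }
  ... | no ¬r∈fibre = contradiction (Any.map (λ h≡r → cong (π pp m) (sym h≡r)) h∈H) ¬r∈fibre

  normalise : M2 pp n → M2 pp n
  normalise h = fibreInverse (π pp m h) ∙ h

  normalise-inKernel : ∀ {h} → h ∈ H → InKernel (normalise h)
  normalise-inKernel {h} h∈H = mulCl s∈H h∈H , (begin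
    π pp m (s ∙ h)                 ≡⟨ π-∙ m≤n s h ⟩
    π pp m s ∙ π pp m h            ≡⟨ cong (π pp m s ∙_) π-representative ⟨
    π pp m s ∙ π pp m r            ≡⟨ π-∙ m≤n s r ⟨
    π pp m (s ∙ r)                 ≡⟨ cong (π pp m) s∙representative ⟩
    π pp m (ε {n})                 ≡⟨ π-ε m≤n ⟩
    ε                              ∎)
    where
    open ≡-Reasoning
    open FibreInverse (fibreInverse-spec h∈H) renaming (representative to r)
    s : M2 pp n
    s = fibreInverse (π pp m h)

  normalise-injective : ∀ {h h′} → h ∈ H → π pp m h ≡ π pp m h′ →
                        normalise h ≡ normalise h′ → h ≡ h′
  normalise-injective {h} {h′} h∈H πh≡πh′ sh≡s′h′ =
    ∙-cancelˡ-by-inverse representative (fibreInverse (π pp m h)) representative∙s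
      (trans sh≡s′h′ (cong (λ x → fibreInverse x ∙ h′) (sym πh≡πh′)))
    where open FibreInverse (fibreInverse-spec h∈H)

  length-≤-image*kernel : ∀ {B : Set} (πH : List (M2 pp m)) (C : List B) (κ : M2 pp n → B) →
    Unique H → (∀ {h} → h ∈ H → π pp m h ∈ πH) → (∀ {k} → InKernel k → κ k ∈ C) →
    (∀ {k k′} → InKernel k → InKernel k′ → κ k ≡ κ k′ → k ≡ k′) →
    length H ≤ length πH * length C
  length-≤-image*kernel {B} πH C κ unique π∈πH κ∈C κ-injective =
    ℕₚ.≤-trans (injectiveOn⇒length≤ f unique f∈ f-injective)
               (ℕₚ.≤-reflexive (length-cartesianProduct πH C))
    where
    f : M2 pp n → M2 pp m × B
    f h = π pp m h , κ (normalise h)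
    f∈ : ∀ {h} → h ∈ H → f h ∈ cartesianProduct πH C
    f∈ h∈H = ∈-cartesianProduct⁺ (π∈πH h∈H) (κ∈C (normalise-inKernel h∈H))
    f-injective : ∀ {h h′} → h ∈ H → h′ ∈ H → f h ≡ f h′ → h ≡ h′
    f-injective h∈H h′∈H fh≡fh′ = normalise-injective h∈H (cong proj₁ fh≡fh′)
      (κ-injective (normalise-inKernel h∈H) (normalise-inKernel h′∈H) (cong proj₂ fh≡fh′))

  module _ (tend : UpperTriTend pp m H) where

    kernel-upperTriangular : ∀ {k} → InKernel k → UpperTriangular (p ^ n) ⌜ k ⌝
    kernel-upperTriangular kK@(k∈H , _) = ∣⇒≡0-mod (tend k∈H (≡0-mod⇒∣ (≋₂₁ (kernel-≋𝟙 kK))))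

    -- In the notation of the statement j = k - 1, and n = j + (j + e).
    module Rigidity {j e : ℕ} (n≡ : n ≡ j + (j + e)) {g : M2 pp n} (g∈H : g ∈ H) {c₀ : ℕ}
                    (c-g : toℕ (c g) ≡ toℕ (red pp n (p ^ j * c₀))) (p∤c₀ : ¬ p ∣ c₀)
                    (p∤trace : ¬ p ∣ (toℕ (a g) + toℕ (d g))) where

      private
        g⁻¹ : M2 pp n
        g⁻¹ = proj₁ (invCl g∈H)
        g⁻¹∈H : g⁻¹ ∈ H
        g⁻¹∈H = proj₁ (proj₂ (invCl g∈H))
        g∙g⁻¹≡ε : g ∙ g⁻¹ ≡ ε
        g∙g⁻¹≡ε = proj₁ (proj₂ (proj₂ (invCl g∈H)))
        g⁻¹∙g≡ε : g⁻¹ ∙ g ≡ ε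
        g⁻¹∙g≡ε = proj₂ (proj₂ (proj₂ (invCl g∈H)))

      ⌜g⌝₂₁≡pʲc₀ : a₂₁ ⌜ g ⌝ ≡ + (p ^ j) ℤ.* + c₀ mod p ^ n
      ⌜g⌝₂₁≡pʲc₀ = subst₂ (λ x y → + x ≡ y mod p ^ n) (sym c-g) (ℤₚ.pos-* (p ^ j) c₀)
                          (red-≡-mod {n} (p ^ j * c₀))

      kernel-rigidity : ∀ {k} → InKernel k →
                        a₁₁ ⌜ k ⌝ ≡ a₂₂ ⌜ k ⌝ mod p ^ (j + e) × a₁₂ ⌜ k ⌝ ≡ 0ℤ mod p ^ e
      kernel-rigidity {k} kK = rigidity n≡
        where
        U V : M2 pp n
        U = g ∙ k ∙ g⁻¹
        V = g⁻¹ ∙ k ∙ g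
        U↑ : UpperTriangular (p ^ n) ⌜ U ⌝
        U↑ = kernel-upperTriangular (kernel-conjugate g∈H g⁻¹∈H g∙g⁻¹≡ε kK)
        K↑ : UpperTriangular (p ^ n) ⌜ k ⌝
        K↑ = kernel-upperTriangular kK
        V↑ : UpperTriangular (p ^ n) ⌜ V ⌝
        V↑ = kernel-upperTriangular (kernel-conjugate g⁻¹∈H g∈H g⁻¹∙g≡ε kK)
        UG≋GK : ⌜ U ⌝ ⊗ ⌜ g ⌝ ≋ ⌜ g ⌝ ⊗ ⌜ k ⌝ mod p ^ n
        UG≋GK = ⌜⌝-intertwining U g k (conjugate-intertwinesʳ {g = g} {g⁻¹} {k} g⁻¹∙g≡ε)
        KG≋GV : ⌜ k ⌝ ⊗ ⌜ g ⌝ ≋ ⌜ g ⌝ ⊗ ⌜ V ⌝ mod p ^ n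
        KG≋GV = ⌜⌝-intertwining k g V (sym (conjugate-intertwinesˡ {g = g} {g⁻¹} {k} g∙g⁻¹≡ε))
        -- Matching on n≡ turns the modulus p ^ n into p ^ (j + (j + e)).
        rigidity : n ≡ j + (j + e) →
                   a₁₁ ⌜ k ⌝ ≡ a₂₂ ⌜ k ⌝ mod p ^ (j + e) × a₁₂ ⌜ k ⌝ ≡ 0ℤ mod p ^ e
        rigidity refl =
            intertwined-diagonal-≡ j (j + e) ⌜ g ⌝ ⌜ U ⌝ ⌜ k ⌝ ⌜ V ⌝ ⌜g⌝₂₁≡pʲc₀ p∤c₀ p∤trace
              U↑ K↑ V↑ UG≋GK KG≋GV
          , intertwined-upperRight-≡0 j e ⌜ g ⌝ ⌜ U ⌝ ⌜ k ⌝ ⌜ V ⌝ ⌜g⌝₂₁≡pʲc₀ p∤c₀ p∤trace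
              U↑ K↑ V↑ UG≋GK KG≋GV

      private instance
        pᵐ≢0 : NonZero (p ^ m)
        pᵐ≢0 = pᵉ-nonZero m
        pʲ⁺ᵉ≢0 : NonZero (p ^ (j + e))
        pʲ⁺ᵉ≢0 = pᵉ-nonZero (j + e)
        pᵉ≢0 : NonZero (p ^ e)
        pᵉ≢0 = pᵉ-nonZero e

      kernel-code : M2 pp n → ℕ × ℕ × ℕ
      kernel-code k = toℕ (a k) / p ^ m , toℕ (d k) / p ^ (j + e) , toℕ (b k) / p ^ e

      kernel-code-injective : ∀ {k k′} → InKernel k → InKernel k′ →
                              kernel-code k ≡ kernel-code k′ → k ≡ k′
      kernel-code-injective {k} {k′} kK k′K code≡ = ⌜⌝-injective (entrywise
          (≡⇒≡-mod (cong +_ a≡a′)) (≡⇒≡-mod (cong +_ b≡b′))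
          (≡-mod-trans (kernel-upperTriangular kK) (≡-mod-sym (kernel-upperTriangular k′K)))
          (≡⇒≡-mod (cong +_ d≡d′)))
        where
        a≡a′ : toℕ (a k) ≡ toℕ (a k′)
        a≡a′ = ≡-mod∧/≡⇒≡ (≋₁₁ (≋-trans (kernel-≋𝟙 kK) (≋-sym (kernel-≋𝟙 k′K))))
                          (cong proj₁ code≡)
        d≡d′ : toℕ (d k) ≡ toℕ (d k′)
        d≡d′ = ≡-mod∧/≡⇒≡
          (≡-mod-trans (≡-mod-sym (proj₁ (kernel-rigidity kK)))
                       (≡-mod-trans (≡⇒≡-mod (cong +_ a≡a′)) (proj₁ (kernel-rigidity k′K))))
          (cong (proj₁ ∘ proj₂) code≡)
        b≡b′ : toℕ (b k) ≡ toℕ (b k′)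
        b≡b′ = ≡-mod∧/≡⇒≡
          (≡-mod-trans (proj₂ (kernel-rigidity kK)) (≡-mod-sym (proj₂ (kernel-rigidity k′K))))
          (cong (proj₂ ∘ proj₂) code≡)

      kernel-codes : List (ℕ × ℕ × ℕ)
      kernel-codes = cartesianProduct (upTo (p ^ (n ∸ m))) (cartesianProduct (upTo (p ^ j)) (upTo (p ^ (j + j))))

      kernel-code∈ : ∀ k → kernel-code k ∈ kernel-codes
      kernel-code∈ k =
        ∈-cartesianProduct⁺ (∈-upTo⁺ (x<pⁱ⁺ᵉ⇒x/pᵉ<pⁱ {m} (n ∸ m) (entry< (ℕₚ.m∸n+n≡m m≤n) (a k))))
          (∈-cartesianProduct⁺ (∈-upTo⁺ (x<pⁱ⁺ᵉ⇒x/pᵉ<pⁱ {j + e} j (entry< (sym n≡) (d k))))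
            (∈-upTo⁺ (x<pⁱ⁺ᵉ⇒x/pᵉ<pⁱ {e} (j + j) (entry< (trans (ℕₚ.+-assoc j j e) (sym n≡)) (b k)))))
        where
        entry< : ∀ {t} → t ≡ n → (x : Fin (p ^ n)) → toℕ x < p ^ t
        entry< refl = toℕ<n

      length-kernel-codes : length kernel-codes ≡ p ^ (n ∸ m) * (p ^ j * p ^ (j + j))
      length-kernel-codes = begin
        length kernel-codes
          ≡⟨ length-cartesianProduct (upTo (p ^ (n ∸ m))) (cartesianProduct (upTo (p ^ j)) (upTo (p ^ (j + j)))) ⟩
        length (upTo (p ^ (n ∸ m))) * length (cartesianProduct (upTo (p ^ j)) (upTo (p ^ (j + j))))
          ≡⟨ cong₂ _*_ (length-upTo (p ^ (n ∸ m))) (length-cartesianProduct (upTo (p ^ j)) (upTo (p ^ (j + j)))) ⟩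
        p ^ (n ∸ m) * (length (upTo (p ^ j)) * length (upTo (p ^ (j + j))))
          ≡⟨ cong (p ^ (n ∸ m) *_) (cong₂ _*_ (length-upTo (p ^ j)) (length-upTo (p ^ (j + j)))) ⟩
        p ^ (n ∸ m) * (p ^ j * p ^ (j + j))
          ∎
        where open ≡-Reasoning

module ExponentArithmetic where

  open import Data.Nat.Tactic.RingSolver using (solve-∀)

  m+2[1+j]∸2≤n⇒j+j≤n : ∀ m n j → m + 2 * suc j ∸ 2 ≤ n → j + j ≤ n
  m+2[1+j]∸2≤n⇒j+j≤n m n j m+2[1+j]∸2≤n =
    ℕₚ.≤-trans (ℕₚ.m≤n+m (j + j) m) (subst (λ x → x ∸ 2 ≤ n) (m+2[1+j]≡2+[m+[j+j]] m j) m+2[1+j]∸2≤n)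
    where
    m+2[1+j]≡2+[m+[j+j]] : ∀ m j → m + 2 * suc j ≡ 2 + (m + (j + j))
    m+2[1+j]≡2+[m+[j+j]] = solve-∀

  pˣ*pʲ*pʲ⁺ʲ≤pˣ⁺⁴ʲ : ∀ p .{{_ : NonZero p}} x j → p ^ x * (p ^ j * p ^ (j + j)) ≤ p ^ (x + 4 * suc j ∸ 4)
  pˣ*pʲ*pʲ⁺ʲ≤pˣ⁺⁴ʲ p x j = begin
    p ^ x * (p ^ j * p ^ (j + j))   ≡⟨ cong (p ^ x *_) (ℕₚ.^-distribˡ-+-* p j (j + j)) ⟨
    p ^ x * p ^ (j + (j + j))       ≡⟨ ℕₚ.^-distribˡ-+-* p x (j + (j + j)) ⟨
    p ^ (x + (j + (j + j)))         ≤⟨ ℕₚ.^-monoʳ-≤ p (ℕₚ.+-monoʳ-≤ x 3j≤4j) ⟩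
    p ^ (x + 4 * j)                 ≡⟨ cong (λ y → p ^ (y ∸ 4)) (x+4[1+j]≡4+[x+4j] x j) ⟨
    p ^ (x + 4 * suc j ∸ 4)         ∎
    where
    open ℕₚ.≤-Reasoning
    3j≤4j : j + (j + j) ≤ 4 * j
    3j≤4j = ℕₚ.+-monoʳ-≤ j (ℕₚ.+-monoʳ-≤ j (ℕₚ.m≤m+n j (j + 0)))
    x+4[1+j]≡4+[x+4j] : ∀ x j → x + 4 * suc j ≡ 4 + (x + 4 * j)
    x+4[1+j]≡4+[x+4j] = solve-∀

open ExponentArithmetic

proposition2p16 : (p : ℕ) (pp : Prime p) (k m n : ℕ) →
    1 ≤ k → k ≤ m → m < n → m + 2 * k ∸ 2 ≤ n →
    (H : List (M2 pp n)) → Unique H → IsSubgroup pp H →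
    UpperTriTend pp m H →
    Σ (M2 pp n) (λ h → (h ∈ H) × Σ ℕ (λ c₀ →
      (toℕ (c h) ≡ toℕ (red pp n (p ^ (k ∸ 1) * c₀))) × (¬ (p ∣ c₀))
      × (¬ (p ∣ (toℕ (a h) + toℕ (d h)))))) →
    (πH : List (M2 pp m)) → Unique πH →
    (∀ x → (x ∈ πH) ⇔ Σ (M2 pp n) (λ h → (h ∈ H) × (π pp m h ≡ x))) →
    length H ≤ p ^ (n ∸ m + 4 * k ∸ 4) * length πH
proposition2p16 p pp (suc j) m n _ _ m<n m+2k∸2≤n H unique-H H≤ tend
                (g , g∈H , c₀ , c-g , p∤c₀ , p∤trace) πH _ πH-image = begin
  length H                                            ≤⟨ |H|≤|πH|*|codes| ⟩
  length πH * length kernel-codes                     ≡⟨ cong (length πH *_) length-kernel-codes ⟩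
  length πH * (p ^ (n ∸ m) * (p ^ j * p ^ (j + j)))   ≤⟨ ℕₚ.*-monoʳ-≤ (length πH) codes≤ ⟩
  length πH * p ^ (n ∸ m + 4 * suc j ∸ 4)             ≡⟨ ℕₚ.*-comm (length πH) _ ⟩
  p ^ (n ∸ m + 4 * suc j ∸ 4) * length πH             ∎
  where
  open ℕₚ.≤-Reasoning
  open PrimePowerCongruence pp using (p≢0)

  e : ℕ
  e = n ∸ (j + j)

  n≡j+[j+e] : n ≡ j + (j + e)
  n≡j+[j+e] = trans (sym (ℕₚ.m+[n∸m]≡n (m+2[1+j]∸2≤n⇒j+j≤n m n j m+2k∸2≤n))) (ℕₚ.+-assoc j j e)

  open KernelOfReduction pp (ℕₚ.<⇒≤ m<n) H H≤
  open Rigidity tend {j} {e} n≡j+[j+e] g∈H c-g p∤c₀ p∤trace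

  codes≤ : p ^ (n ∸ m) * (p ^ j * p ^ (j + j)) ≤ p ^ (n ∸ m + 4 * suc j ∸ 4)
  codes≤ = pˣ*pʲ*pʲ⁺ʲ≤pˣ⁺⁴ʲ p (n ∸ m) j

  |H|≤|πH|*|codes| : length H ≤ length πH * length kernel-codes
  |H|≤|πH|*|codes| = length-≤-image*kernel πH kernel-codes kernel-code unique-H
    (λ {h} h∈H → Equivalence.from (πH-image (π pp m h)) (h , h∈H , refl))
    (λ {k} _ → kernel-code∈ k) kernel-code-injective
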